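{- Let $A=\{a_1,\ldots,a_m\}$ be a finite set with $|A|=m$ and let $\mathbb{F}$ be a finite field of odd characteristic. For each $a\in A$ let $c_a\in\mathbb{F}$ be nonzero. Define $T:A\times A\to\mathbb{F}$ by $$T(y,z)=\sum_{a\in A}c_a\bigl(\delta_a(y)\delta_a(z)+(1-\delta_a(y))(1-\delta_a(z))\bigr).$$ Then the rank of $T$ is at least $m-2$.
   Context: For $a\in A$, $\delta_a:A\to\mathbb{F}$ is the Kronecker function: $\delta_a(x)=1$ if $x=a$ and $\delta_a(x)=0$ otherwise. A function $T:A\times A\to\mathbb{F}$ is rank one if it is nonzero and of the form $T(y,z)=f(y)g(z)$ for some functions $f,g:A\to\mathbb{F}$. The rank of a general $T:A\times A\to\mathbb{F}$ is the least number of rank one functions needed to express $T$ as a linear combination (the zero function has rank $0$). -}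

module Defs where

open import Level using (Level; _⊔_; suc)
open import Algebra.Bundles using (CommutativeRing)
open import Data.Nat as ℕ using (ℕ; zero; suc; _<_; _≤_)
open import Data.Nat.Divisibility using (_∣_)
import Data.Fin
open Data.Fin using (Fin)
import Relation.Nullary
open import Data.Product using (Σ; ∃; ∃-syntax; _×_; _,_)
open import Relation.Nullary using (¬_)

record Field (c ℓ : Level) : Set (Level.suc (c ⊔ ℓ)) where
  field
    commutativeRing : CommutativeRing c ℓ
  open CommutativeRing commutativeRing public
  field
    1≉0     : ¬ (1# ≈ 0#)
    inverse : ∀ x → ¬ (x ≈ 0#) → ∃[ y ] (x * y ≈ 1#)

module _ {c ℓ : Level} (F : Field c ℓ) where
  open Field F

  IsFinite : Set (c ⊔ ℓ)
  IsFinite = Σ ℕ (λ q → Σ (Fin q → Carrier) (λ e → ∀ (x : Carrier) → ∃[ i ] (x ≈ e i)))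

  natF : ℕ → Carrier
  natF zero    = 0#
  natF (suc n) = 1# + natF n

  HasCharacteristic : ℕ → Set ℓ
  HasCharacteristic p =
    (0 < p) × (natF p ≈ 0#) × (∀ k → 0 < k → k < p → ¬ (natF k ≈ 0#))

  OddCharacteristic : Set ℓ
  OddCharacteristic = ∃[ p ] (HasCharacteristic p × ¬ (2 ∣ p))

  Σ[<] : (n : ℕ) → (Fin n → Carrier) → Carrier
  Σ[<] zero    f = 0#
  Σ[<] (suc n) f = f Fin.zero + Σ[<] n (λ i → f (Fin.suc i))

  δ : ∀ {m} → Fin m → Fin m → Carrier
  δ a x with a Data.Fin.≟ x
  ... | Relation.Nullary.yes _ = 1#
  ... | Relation.Nullary.no  _ = 0#

  IsRankOne : ∀ {m} → (Fin m → Fin m → Carrier) → Set (c ⊔ ℓ)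
  IsRankOne {m} T =
    (∃[ y ] ∃[ z ] ¬ (T y z ≈ 0#)) ×
    Σ (Fin m → Carrier) (λ f → Σ (Fin m → Carrier) (λ g →
      ∀ y z → T y z ≈ f y * g z))

  IsCombOf : ∀ {m} → (Fin m → Fin m → Carrier) → ℕ → Set (c ⊔ ℓ)
  IsCombOf {m} T r =
    Σ (Fin r → Carrier) (λ λs → Σ (Fin r → Fin m → Fin m → Carrier) (λ R →
      (∀ (i : Fin r) → IsRankOne {m} (R i)) ×
      (∀ y z → T y z ≈ Σ[<] r (λ i → λs i * R i y z))))

  RankAtLeast : ∀ {m} → (Fin m → Fin m → Carrier) → ℕ → Set (c ⊔ ℓ)
  RankAtLeast {m} T k = ∀ r → IsCombOf {m} T r → k ≤ r

  Tc : ∀ {m} → (Fin m → Carrier) → Fin m → Fin m → Carrier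
  Tc {m} cc y z =
    Σ[<] m (λ a → cc a * (δ a y * δ a z + (1# - δ a y) * (1# - δ a z)))

-- Since δ_a(y)δ_a(z) + (1 − δ_a(y))(1 − δ_a(z)) = 2δ_a(y)δ_a(z) + 1 − δ_a(y) − δ_a(z),
-- putting v_y = Σ_a c_a (δ_a(y) − 1/2) makes T + v 1ᵀ + 1 vᵀ the diagonal matrix
-- diag(2c_y), which is nonsingular as the characteristic is odd.  The two border terms
-- have rank one, so m ≤ rank T + 2.  A nonsingular diagonal m × m matrix U Wᵀ, with k
-- columns in U and W, has m ≤ k: Gaussian elimination reduces it to size (m−1) × (k−1).
-- Equality in the field is not decidable, so the pivot is chosen under a double
-- negation; this is harmless because the goal m ≤ k is decidable.
module Submission where

open import Defs
open import Level using (Level)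
open import Algebra.Bundles using (CommutativeRing)
open import Data.Nat using (ℕ; zero; suc; _∸_; _≤_; s≤s; z≤n)
open import Data.Nat.Properties using (_≤?_; m≤n⇒m≤1+n; m≤n+o⇒m∸n≤o)
open import Data.Nat.Divisibility using (_∣_; ∣-refl)
open import Data.Fin using (Fin; zero; suc; punchIn; _≟_)
open import Data.Fin.Properties using (punchIn-injective; punchInᵢ≢i)
open import Data.Vec.Functional using (Vector; _∷_; tail)
open import Data.Product using (∃; ∃₂; _,_; proj₁; proj₂)
open import Data.Empty using (⊥-elim)
open import Function using (_∘_)
open import Relation.Nullary using (¬_; yes; no)
open import Relation.Nullary.Decidable using (decidable-stable)
open import Relation.Binary.PropositionalEquality as ≡ using (_≡_; _≢_)

double-negation-shift : ∀ {p n} {P : Fin n → Set p} → (∀ i → ¬ ¬ P i) → ¬ ¬ (∀ i → P i)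
double-negation-shift {n = zero}  ¬¬P ¬∀P = ¬∀P (λ ())
double-negation-shift {n = suc n} ¬¬P ¬∀P =
  ¬¬P zero λ P₀ → double-negation-shift (¬¬P ∘ suc) λ P₊ →
    ¬∀P λ { zero → P₀ ; (suc i) → P₊ i }

module MatrixProduct {c ℓ} (R : CommutativeRing c ℓ) where
  open CommutativeRing R hiding (zero)
  open import Algebra.Properties.Semiring.Sum semiring
    using (sum; ∑-distrib-+; *-distribˡ-sum; sum-cong-≋; sum-remove; sum-replicate-zero)
  open import Relation.Binary.Reasoning.Setoid setoid

  Matrix : ℕ → ℕ → Set c
  Matrix m n = Fin m → Fin n → Carrier

  infixl 7 _*ᵀ_
  _*ᵀ_ : ∀ {m n k} → Matrix m k → Matrix n k → Matrix m n
  (U *ᵀ W) y z = sum λ i → U y i * W z i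

  sum-≈0 : ∀ {n} (t : Vector Carrier n) → (∀ i → t i ≈ 0#) → sum t ≈ 0#
  sum-≈0 {n} t t≈0 = trans (sum-cong-≋ t≈0) (sum-replicate-zero n)

  sum-supported : ∀ {n} (t : Vector Carrier n) j → (∀ i → i ≢ j → t i ≈ 0#) → sum t ≈ t j
  sum-supported {suc n} t j t≈0 = begin
    sum t                        ≈⟨ sum-remove {i = j} t ⟩
    t j + sum (t ∘ punchIn j)    ≈⟨ +-congˡ (sum-≈0 _ λ i → t≈0 (punchIn j i) (punchInᵢ≢i j i)) ⟩
    t j + 0#                     ≈⟨ +-identityʳ _ ⟩
    t j                          ∎

  addRow : ∀ {m k} → Fin m → Vector Carrier m → Matrix m k → Matrix m k
  addRow p s U y i = U y i + s y * U p i

  *ᵀ-addRow : ∀ {m n k} p s (U : Matrix m k) (W : Matrix n k) y z →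
              (addRow p s U *ᵀ W) y z ≈ (U *ᵀ W) y z + s y * (U *ᵀ W) p z
  *ᵀ-addRow p s U W y z = begin
    sum (λ i → (U y i + s y * U p i) * W z i)         ≈⟨ sum-cong-≋ (λ i → expand (U y i) (s y) (U p i) (W z i)) ⟩
    sum (λ i → U y i * W z i + s y * (U p i * W z i)) ≈⟨ ∑-distrib-+ (λ i → U y i * W z i) (λ i → s y * (U p i * W z i)) ⟩
    (U *ᵀ W) y z + sum (λ i → s y * (U p i * W z i))  ≈⟨ +-congˡ (*-distribˡ-sum (s y) (λ i → U p i * W z i)) ⟨
    (U *ᵀ W) y z + s y * (U *ᵀ W) p z                  ∎
    where
    expand : ∀ a s b w → (a + s * b) * w ≈ a * w + s * (b * w)
    expand a s b w = trans (distribʳ w a (s * b)) (+-congˡ (*-assoc s b w))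

  *ᵀ-dropZeroColumn : ∀ {m n k} (U : Matrix m (suc k)) (W : Matrix n (suc k)) →
                      (∀ y → U y zero ≈ 0#) → ∀ y z → (U *ᵀ W) y z ≈ (tail ∘ U *ᵀ tail ∘ W) y z
  *ᵀ-dropZeroColumn U W U≈0 y z =
    trans (+-congʳ (trans (*-congʳ (U≈0 y)) (zeroˡ _))) (+-identityˡ _)

  record IsNonsingularDiagonal {m} (M : Matrix m m) : Set ℓ where
    field
      diagonal≉0    : ∀ y → ¬ (M y y ≈ 0#)
      offDiagonal≈0 : ∀ {y z} → y ≢ z → M y z ≈ 0#

  open IsNonsingularDiagonal public

  isNonsingularDiagonal-resp : ∀ {m} {M N : Matrix m m} → (∀ y z → M y z ≈ N y z) →
                               IsNonsingularDiagonal M → IsNonsingularDiagonal N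
  isNonsingularDiagonal-resp M≈N diag = record
    { diagonal≉0    = λ y N≈0 → diagonal≉0 diag y (trans (M≈N y y) N≈0)
    ; offDiagonal≈0 = λ y≢z → trans (sym (M≈N _ _)) (offDiagonal≈0 diag y≢z)
    }

  isNonsingularDiagonal-minor : ∀ {m} {M : Matrix (suc m) (suc m)} p → IsNonsingularDiagonal M →
    IsNonsingularDiagonal (λ y z → M (punchIn p y) (punchIn p z))
  isNonsingularDiagonal-minor p diag = record
    { diagonal≉0    = diagonal≉0 diag ∘ punchIn p
    ; offDiagonal≈0 = λ y≢z → offDiagonal≈0 diag (y≢z ∘ punchIn-injective p _ _)
    }

  isNonsingularDiagonal-dropZeroColumn : ∀ {m k} (U W : Matrix m (suc k)) → (∀ y → U y zero ≈ 0#) →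
    IsNonsingularDiagonal (U *ᵀ W) → IsNonsingularDiagonal (tail ∘ U *ᵀ tail ∘ W)
  isNonsingularDiagonal-dropZeroColumn U W U≈0 =
    isNonsingularDiagonal-resp (*ᵀ-dropZeroColumn U W U≈0)

module FieldProperties {c ℓ} (F : Field c ℓ) where
  open Field F hiding (zero)
  open MatrixProduct commutativeRing
  open import Algebra.Properties.Semiring.Sum semiring using (sum; ∑-distrib-+; sum-cong-≋)
  open import Algebra.Properties.Ring ring using (-‿distribˡ-*)
  open import Algebra.Properties.AbelianGroup +-abelianGroup using (⁻¹-∙-comm)
  open import Algebra.Solver.Ring.NaturalCoefficients.Default commutativeSemiring
    using (solve; _:=_; _:+_; _:*_)
  open import Relation.Binary.Reasoning.Setoid setoid

  Σ[<]≗sum : ∀ n (f : Fin n → Carrier) → Σ[<] F n f ≡ sum f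
  Σ[<]≗sum zero    f = ≡.refl
  Σ[<]≗sum (suc n) f = ≡.cong (f zero +_) (Σ[<]≗sum n (f ∘ suc))

  x*y≈0⇒y≈0 : ∀ {x y} → ¬ (x ≈ 0#) → x * y ≈ 0# → y ≈ 0#
  x*y≈0⇒y≈0 {x} {y} x≉0 xy≈0 = begin
    y              ≈⟨ sym (*-identityˡ y) ⟩
    1# * y         ≈⟨ *-congʳ (sym x⁻¹x≈1) ⟩
    (x⁻¹ * x) * y  ≈⟨ *-assoc _ _ _ ⟩
    x⁻¹ * (x * y)  ≈⟨ *-congˡ xy≈0 ⟩
    x⁻¹ * 0#       ≈⟨ zeroʳ _ ⟩
    0#             ∎
    where
    x⁻¹ = proj₁ (inverse x x≉0)
    x⁻¹x≈1 = trans (*-comm x⁻¹ x) (proj₂ (inverse x x≉0))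

  x+x≉0 : ¬ (1# + 1# ≈ 0#) → ∀ {x} → ¬ (x ≈ 0#) → ¬ (x + x ≈ 0#)
  x+x≉0 2≉0 {x} x≉0 x+x≈0 = x≉0 (x*y≈0⇒y≈0 2≉0 (begin
    (1# + 1#) * x   ≈⟨ distribʳ x 1# 1# ⟩
    1# * x + 1# * x ≈⟨ +-cong (*-identityˡ x) (*-identityˡ x) ⟩
    x + x           ≈⟨ x+x≈0 ⟩
    0#              ∎))

  minusHalf : ¬ (1# + 1# ≈ 0#) → ∃ λ n → 1# + (n + n) ≈ 0#
  minusHalf 2≉0 = - h , (begin
    1# + (- h + - h)  ≈⟨ +-congˡ (⁻¹-∙-comm h h) ⟩
    1# - (h + h)      ≈⟨ +-congˡ (-‿cong h+h≈1) ⟩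
    1# - 1#           ≈⟨ -‿inverseʳ 1# ⟩
    0#                ∎)
    where
    h = proj₁ (inverse (1# + 1#) 2≉0)
    h+h≈1 = begin
      h + h            ≈⟨ +-cong (*-identityˡ h) (*-identityˡ h) ⟨
      1# * h + 1# * h  ≈⟨ distribʳ h 1# 1# ⟨
      (1# + 1#) * h    ≈⟨ proj₂ (inverse (1# + 1#) 2≉0) ⟩
      1#               ∎

  oddCharacteristic⇒1+1≉0 : OddCharacteristic F → ¬ (1# + 1# ≈ 0#)
  oddCharacteristic⇒1+1≉0 (p , char , 2∤p) 1+1≈0 =
    natF2≉0 p char 2∤p (trans (+-congˡ (+-identityʳ 1#)) 1+1≈0)
    where
    natF2≉0 : ∀ p → HasCharacteristic F p → ¬ (2 ∣ p) → ¬ (natF F 2 ≈ 0#)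
    natF2≉0 1 (_ , 1+0≈0 , _) _ _ = 1≉0 (trans (sym (+-identityʳ 1#)) 1+0≈0)
    natF2≉0 2 _ 2∤2 _ = 2∤2 ∣-refl
    natF2≉0 (suc (suc (suc p))) (_ , _ , minimal) _ = minimal 2 (s≤s z≤n) (s≤s (s≤s (s≤s z≤n)))

  -- The pivot is U p 0: adding multiples of row p clears column 0, and as the product
  -- is diagonal this leaves the entries outside row and column p unchanged.
  isNonsingularDiagonal-pivot : ∀ {m k} (U W : Matrix (suc m) (suc k)) p → ¬ (U p zero ≈ 0#) →
    IsNonsingularDiagonal (U *ᵀ W) → ∃₂ λ (U′ W′ : Matrix m k) → IsNonsingularDiagonal (U′ *ᵀ W′)
  isNonsingularDiagonal-pivot {m} {k} U W p Up≉0 diag =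
    tail ∘ U′ ∘ punchIn p , tail ∘ W ∘ punchIn p ,
    isNonsingularDiagonal-resp (λ y z → unchanged (punchIn p y) (punchIn p z) (punchInᵢ≢i p z))
      (isNonsingularDiagonal-minor p diag)
    where
    β : Carrier
    β = proj₁ (inverse (U p zero) Up≉0)

    s : Vector Carrier (suc m)
    s y = - (U y zero * β)

    U′ : Matrix (suc m) (suc k)
    U′ = addRow p s U

    column-cleared : ∀ y → U′ y zero ≈ 0#
    column-cleared y = begin
      a + - (a * β) * b  ≈⟨ +-congˡ (-‿distribˡ-* (a * β) b) ⟨
      a - a * β * b      ≈⟨ +-congˡ (-‿cong (*-assoc a β b)) ⟩
      a - a * (β * b)    ≈⟨ +-congˡ (-‿cong (*-congˡ (trans (*-comm β b) (proj₂ (inverse b Up≉0))))) ⟩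
      a - a * 1#         ≈⟨ +-congˡ (-‿cong (*-identityʳ a)) ⟩
      a - a              ≈⟨ -‿inverseʳ a ⟩
      0#                 ∎
      where
      a = U y zero
      b = U p zero

    unchanged : ∀ y z → z ≢ p → (U *ᵀ W) y z ≈ (tail ∘ U′ *ᵀ tail ∘ W) y z
    unchanged y z z≢p = begin
      (U *ᵀ W) y z                       ≈⟨ +-identityʳ _ ⟨
      (U *ᵀ W) y z + 0#                  ≈⟨ +-congˡ (trans (*-congˡ (offDiagonal≈0 diag (z≢p ∘ ≡.sym))) (zeroʳ _)) ⟨
      (U *ᵀ W) y z + s y * (U *ᵀ W) p z  ≈⟨ *ᵀ-addRow p s U W y z ⟨
      (U′ *ᵀ W) y z                      ≈⟨ *ᵀ-dropZeroColumn U′ W column-cleared y z ⟩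
      (tail ∘ U′ *ᵀ tail ∘ W) y z        ∎

  isNonsingularDiagonal⇒≤ : ∀ {m k} (U W : Matrix m k) → IsNonsingularDiagonal (U *ᵀ W) → m ≤ k
  isNonsingularDiagonal⇒≤ {zero}          U W _    = z≤n
  isNonsingularDiagonal⇒≤ {suc m} {zero}  U W diag = ⊥-elim (diagonal≉0 diag zero refl)
  isNonsingularDiagonal⇒≤ {suc m} {suc k} U W diag = decidable-stable (suc m ≤? suc k) λ m≰k →
    double-negation-shift {P = λ p → U p zero ≈ 0#}
      (λ p Up≉0 → m≰k (s≤s (viaPivot p Up≉0)))
      (λ column≈0 → m≰k (m≤n⇒m≤1+n (isNonsingularDiagonal⇒≤ _ _
        (isNonsingularDiagonal-dropZeroColumn U W column≈0 diag))))
    where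
    viaPivot : ∀ p → ¬ (U p zero ≈ 0#) → m ≤ k
    viaPivot p Up≉0 with isNonsingularDiagonal-pivot U W p Up≉0 diag
    ... | U′ , W′ , diag′ = isNonsingularDiagonal⇒≤ U′ W′ diag′

  isCombOf⇒*ᵀ : ∀ {m r} {T : Matrix m m} → IsCombOf F T r →
                ∃₂ λ (P Q : Matrix m r) → ∀ y z → T y z ≈ (P *ᵀ Q) y z
  isCombOf⇒*ᵀ {r = r} {T} (λs , R , rankOne , T≈) = P , Q , λ y z → begin
    T y z                             ≈⟨ T≈ y z ⟩
    Σ[<] F r (λ i → λs i * R i y z)   ≡⟨ Σ[<]≗sum r _ ⟩
    sum (λ i → λs i * R i y z)        ≈⟨ sum-cong-≋ (λ i → trans (*-congˡ (factorisation i y z)) (sym (*-assoc (λs i) (f i y) (g i z)))) ⟩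
    (P *ᵀ Q) y z                      ∎
    where
    f = λ i → proj₁ (proj₂ (rankOne i))
    g = λ i → proj₁ (proj₂ (proj₂ (rankOne i)))
    P = λ y i → λs i * f i y
    Q = λ z i → g i z
    factorisation = λ i → proj₂ (proj₂ (proj₂ (rankOne i)))

  δ-refl : ∀ {m} (a : Fin m) → δ F a a ≡ 1#
  δ-refl a with a ≟ a
  ... | yes _   = ≡.refl
  ... | no a≢a = ⊥-elim (a≢a ≡.refl)

  δ-≢ : ∀ {m} {a x : Fin m} → a ≢ x → δ F a x ≡ 0#
  δ-≢ {a = a} {x} a≢x with a ≟ x
  ... | yes a≡x = ⊥-elim (a≢x a≡x)
  ... | no _    = ≡.refl

  ∑δδ≈ : ∀ {m} (d : Fin m → Carrier) y z → (sum λ a → d a * (δ F a y * δ F a z)) ≈ d y * δ F y z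
  ∑δδ≈ d y z = trans (sum-supported _ y vanishes) (*-congˡ (trans (*-congʳ (reflexive (δ-refl y))) (*-identityˡ _)))
    where
    vanishes : ∀ a → a ≢ y → d a * (δ F a y * δ F a z) ≈ 0#
    vanishes a a≢y = trans (*-congˡ (trans (*-congʳ (reflexive (δ-≢ a≢y))) (zeroˡ _))) (zeroʳ _)

  isNonsingularDiagonal-∑δδ : ∀ {m} (d : Fin m → Carrier) → (∀ a → ¬ (d a ≈ 0#)) →
    IsNonsingularDiagonal (λ y z → sum λ a → d a * (δ F a y * δ F a z))
  isNonsingularDiagonal-∑δδ d d≉0 = record
    { diagonal≉0    = λ y ∑≈0 → d≉0 y (begin
        d y            ≈⟨ *-identityʳ (d y) ⟨
        d y * 1#       ≡⟨ ≡.cong (d y *_) (δ-refl y) ⟨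
        d y * δ F y y  ≈⟨ ∑δδ≈ d y y ⟨
        _              ≈⟨ ∑≈0 ⟩
        0#             ∎)
    ; offDiagonal≈0 = λ y≢z → trans (∑δδ≈ d _ _) (trans (*-congˡ (reflexive (δ-≢ y≢z))) (zeroʳ _))
    }

  x+[1-x]≈1 : ∀ x → x + (1# - x) ≈ 1#
  x+[1-x]≈1 x = begin
    x + (1# - x)    ≈⟨ +-congˡ (+-comm 1# (- x)) ⟩
    x + (- x + 1#)  ≈⟨ +-assoc x (- x) 1# ⟨
    (x - x) + 1#    ≈⟨ +-congʳ (-‿inverseʳ x) ⟩
    0# + 1#         ≈⟨ +-identityˡ 1# ⟩
    1#              ∎

  -- Substituting e = e(f + f′), f = (e + e′)f and 1 = (e + e′)(f + f′), with e′ = 1 − e and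
  -- f′ = 1 − f, turns this into a semiring identity.
  K-identity : ∀ e f → e + (f + (e * f + (1# - e) * (1# - f))) ≈ (e * f + e * f) + 1#
  K-identity e f = begin
    e + (f + (e * f + e′ * f′))                         ≈⟨ +-cong e≈ (+-congʳ f≈) ⟩
    e * (f + f′) + ((e + e′) * f + (e * f + e′ * f′))   ≈⟨ expand e f e′ f′ ⟩
    (e * f + e * f) + (e + e′) * (f + f′)               ≈⟨ +-congˡ 1≈ ⟨
    (e * f + e * f) + 1#                                ∎
    where
    e′ = 1# - e
    f′ = 1# - f
    e≈ = sym (trans (*-congˡ (x+[1-x]≈1 f)) (*-identityʳ e))
    f≈ = sym (trans (*-congʳ (x+[1-x]≈1 e)) (*-identityˡ f))
    1≈ = sym (trans (*-cong (x+[1-x]≈1 e) (x+[1-x]≈1 f)) (*-identityʳ 1#))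
    expand : ∀ e f e′ f′ → e * (f + f′) + ((e + e′) * f + (e * f + e′ * f′)) ≈ (e * f + e * f) + (e + e′) * (f + f′)
    expand = solve 4 (λ e f e′ f′ → (e :* (f :+ f′) :+ ((e :+ e′) :* f :+ (e :* f :+ e′ :* f′)))
                                  := ((e :* f :+ e :* f) :+ (e :+ e′) :* (f :+ f′))) refl

  Tc-border : ∀ {m} → (Fin m → Carrier) → Carrier → Fin m → Carrier
  Tc-border cc n y = sum λ a → cc a * (δ F a y + n)

  Tc-bordered : ∀ {m} (cc : Fin m → Carrier) {n} → 1# + (n + n) ≈ 0# → ∀ y z →
    Tc-border cc n y + (Tc-border cc n z + Tc F cc y z) ≈ (sum λ a → (cc a + cc a) * (δ F a y * δ F a z))
  Tc-bordered {m} cc {n} 1+2n≈0 y z = begin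
    sum A + (sum B + Tc F cc y z)  ≡⟨ ≡.cong (λ t → sum A + (sum B + t)) (Σ[<]≗sum m C) ⟩
    sum A + (sum B + sum C)        ≈⟨ +-congˡ (∑-distrib-+ B C) ⟨
    sum A + sum (λ a → B a + C a)  ≈⟨ ∑-distrib-+ A _ ⟨
    sum (λ a → A a + (B a + C a))  ≈⟨ sum-cong-≋ (λ a → pointwise (cc a) (δ F a y) (δ F a z)) ⟩
    (sum λ a → (cc a + cc a) * (δ F a y * δ F a z)) ∎
    where
    K = λ e f → e * f + (1# - e) * (1# - f)
    A = λ a → cc a * (δ F a y + n)
    B = λ a → cc a * (δ F a z + n)
    C = λ a → cc a * K (δ F a y) (δ F a z)
    pointwise : ∀ c e f → c * (e + n) + (c * (f + n) + c * K e f) ≈ (c + c) * (e * f)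
    pointwise c e f = begin
      c * (e + n) + (c * (f + n) + c * K e f)     ≈⟨ solve 5 (λ c e f n k → (c :* (e :+ n) :+ (c :* (f :+ n) :+ c :* k))
                                                        := (c :* (e :+ (f :+ k)) :+ c :* (n :+ n))) refl c e f n (K e f) ⟩
      c * (e + (f + K e f)) + c * (n + n)         ≈⟨ +-congʳ (*-congˡ (K-identity e f)) ⟩
      c * ((e * f + e * f) + 1#) + c * (n + n)    ≈⟨ solve 4 (λ c p o n → (c :* ((p :+ p) :+ o) :+ c :* (n :+ n))
                                                        := ((c :+ c) :* p :+ c :* (o :+ (n :+ n)))) refl c (e * f) 1# n ⟩
      (c + c) * (e * f) + c * (1# + (n + n))      ≈⟨ +-congˡ (trans (*-congˡ 1+2n≈0) (zeroʳ c)) ⟩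
      (c + c) * (e * f) + 0#                      ≈⟨ +-identityʳ _ ⟩
      (c + c) * (e * f)                           ∎

  Tc-rankAtLeast : ¬ (1# + 1# ≈ 0#) → ∀ {m} (cc : Fin m → Carrier) → (∀ a → ¬ (cc a ≈ 0#)) →
                   RankAtLeast F (Tc F cc) (m ∸ 2)
  Tc-rankAtLeast 2≉0 {m} cc cc≉0 r comb = m≤n+o⇒m∸n≤o m 2 (isNonsingularDiagonal⇒≤ U W UWᵀ-diagonal)
    where
    n = proj₁ (minusHalf 2≉0)
    1+2n≈0 = proj₂ (minusHalf 2≉0)
    v = Tc-border cc n
    P = proj₁ (isCombOf⇒*ᵀ comb)
    Q = proj₁ (proj₂ (isCombOf⇒*ᵀ comb))
    T≈PQᵀ = proj₂ (proj₂ (isCombOf⇒*ᵀ comb))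
    U W : Matrix m (suc (suc r))
    U y = v y ∷ 1# ∷ P y
    W z = 1# ∷ v z ∷ Q z
    UWᵀ-diagonal : IsNonsingularDiagonal (U *ᵀ W)
    UWᵀ-diagonal = isNonsingularDiagonal-resp
      (λ y z → trans (sym (Tc-bordered cc 1+2n≈0 y z))
                     (+-cong (sym (*-identityʳ _)) (+-cong (sym (*-identityˡ _)) (T≈PQᵀ y z))))
      (isNonsingularDiagonal-∑δδ _ λ a → x+x≉0 2≉0 (cc≉0 a))

lemma2 : ∀ {c ℓ : Level} (F : Field c ℓ) → IsFinite F → OddCharacteristic F →
    (m : ℕ) (cc : Fin m → Field.Carrier F) →
    (∀ a → ¬ (Field._≈_ F (cc a) (Field.0# F))) →
    RankAtLeast F (Tc F cc) (m ∸ 2)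
lemma2 F _ odd m cc cc≉0 = Tc-rankAtLeast (oddCharacteristic⇒1+1≉0 odd) cc cc≉0
  where open FieldProperties F
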